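{- Let $d\geq3$ be an integer. Then $2d+1\mid H_d(3d+2)$ if and only if $2d+1\mid d!-1$. If additionally $d$ is odd, then: (i) $2d+1\mid H_{2d+1}(3d+2)$ if and only if $2d+1\mid (d!)^2-1$; (ii) $2d+1\mid H_d(4d)$ if and only if $2d+1\mid d!+1$; (iii) $2d+1\mid H_{2d+1}(4d)$ if and only if $2d+1\mid (d!)^2-1$.
   Context: For an integer $e\geq2$ and $n\ge0$, $H_e(n)$ is the number of permutations in $S_n$ that are products of pairwise disjoint $e$-cycles (identity included); equivalently $H_e(n)=\sum_{k=0}^{\lfloor n/e\rfloor}\frac{n!}{(n-ek)!\,k!\,e^k}$. -}

module Defs where

open import Data.Nat using (ℕ; zero; suc; _+_; _*_; _∸_; _^_; _/_)
open import Data.Nat using (_!)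
open import Data.Nat.Properties using (m^n≢0; m*n≢0; _!≢0)
open import Data.Nat.Base using (NonZero)

-- The summand n! / ((n - e k)! k! e^k) for e ≥ 2 (exact division;
-- for e·k ≤ n this is a natural number).
-- The divisor is nonzero when e is nonzero.
term : (e : ℕ) → .{{NonZero e}} → ℕ → ℕ → ℕ
term e n k = _/_ (n !) (((n ∸ e * k) !) * (k !) * (e ^ k))
  {{m*n≢0 (((n ∸ e * k) !) * (k !)) (e ^ k)
     {{m*n≢0 ((n ∸ e * k) !) (k !) {{(n ∸ e * k) !≢0}} {{k !≢0}}}} {{m^n≢0 e k}}}}

sumUpTo : (e : ℕ) → .{{NonZero e}} → ℕ → ℕ → ℕ
sumUpTo e n zero = term e n zero
sumUpTo e n (suc m) = sumUpTo e n m + term e n (suc m)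

-- H_e(n) = Σ_{k=0}^{⌊n/e⌋} n! / ((n-ek)! k! e^k)
-- (Only used for e ≥ 2; the value at e = 0 is an irrelevant junk value 0.)
H : ℕ → ℕ → ℕ
H zero n = 0
H (suc e) n = sumUpTo (suc e) n (n / suc e)

{-# OPTIONS --safe #-}
module Submission where

-- Write p = 2d + 1 and rising a m = (a+1)(a+2)⋯(a+m). The k-th summand of H_e(n) satisfies
-- term · k! e^k = rising (n − ek) (ek), a block of ek consecutive integers. Modulo p such a
-- block can be shifted by p and reflected (x ≡ −y when p ∣ x + y); this turns each summand
-- with k = 1 into d!, −d! or −(d!)², the last via (2d)! = d! · rising d d ≡ −(d!)² for odd d.
-- Every summand with k ≥ 2 is a multiple of p because its block contains p together with the
-- multiples d, 2d, …, kd that absorb k! d^k.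

open import Defs
open import Data.Integer.Base as ℤ using (ℤ; +_; 0ℤ; 1ℤ; -1ℤ)
import Data.Integer.Divisibility.Signed as ℤ∣
import Data.Integer.Properties as ℤP
import Data.Integer.Tactic.RingSolver as ℤ-Ring
open import Data.List.Base using (List; []; _∷_)
open import Data.Nat.Base
  using (ℕ; zero; suc; _+_; _*_; _∸_; _^_; _≤_; _<_; _!; _/_; NonZero; >-nonZero; >-nonZero⁻¹; s≤s; z≤n; z<s; s<s)
open import Data.Nat.Coprimality using (Coprime; coprime-divisor)
open import Data.Nat.Divisibility
open import Data.Nat.DivMod using (/-congˡ; m*n/n≡m; +-distrib-/-∣ʳ; m<n⇒m/n≡0)
open import Data.Nat.ListAction using (product)
open import Data.Nat.Properties
open import Algebra.Properties.CommutativeSemigroup *-commutativeSemigroup using (x∙yz≈y∙xz; x∙yz≈xz∙y)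
open import Data.Nat.Tactic.RingSolver using (solve)
open import Data.Product.Base using (_,_; ∃; _×_; ∃-syntax)
open import Function.Base using (_∘_; _∋_)
open import Function.Bundles using (_⇔_; mk⇔)
open import Level using (0ℓ)
open import Relation.Binary.Bundles using (Setoid)
open import Relation.Binary.Definitions using (Reflexive; Symmetric; Transitive)
open import Relation.Binary.PropositionalEquality
import Relation.Binary.Reasoning.Setoid

-- Rising factorials

rising : ℕ → ℕ → ℕ
rising a zero    = 1
rising a (suc m) = suc a * rising (suc a) m

rising-+ : ∀ a m n → rising a (m + n) ≡ rising a m * rising (a + m) n
rising-+ a zero    n = trans (cong (λ b → rising b n) (sym (+-identityʳ a))) (sym (*-identityˡ _))
rising-+ a (suc m) n = begin
  suc a * rising (suc a) (m + n)                    ≡⟨ cong (suc a *_) (rising-+ (suc a) m n) ⟩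
  suc a * (rising (suc a) m * rising (suc a + m) n) ≡⟨ *-assoc (suc a) (rising (suc a) m) _ ⟨
  rising a (suc m) * rising (suc (a + m)) n         ≡⟨ cong (λ b → rising a (suc m) * rising b n) (+-suc a m) ⟨
  rising a (suc m) * rising (a + suc m) n           ∎
  where open ≡-Reasoning

[a+m]!≡a!*rising : ∀ a m → (a + m) ! ≡ a ! * rising a m
[a+m]!≡a!*rising a zero    = trans (cong _! (+-identityʳ a)) (sym (*-identityʳ (a !)))
[a+m]!≡a!*rising a (suc m) = begin
  (a + suc m) !                  ≡⟨ cong _! (+-suc a m) ⟩
  (suc a + m) !                  ≡⟨ [a+m]!≡a!*rising (suc a) m ⟩
  suc a * a ! * rising (suc a) m ≡⟨ cong (_* rising (suc a) m) (*-comm (suc a) (a !)) ⟩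
  a ! * suc a * rising (suc a) m ≡⟨ *-assoc (a !) _ _ ⟩
  a ! * rising a (suc m)         ∎
  where open ≡-Reasoning

rising[0,n]≡n! : ∀ n → rising 0 n ≡ n !
rising[0,n]≡n! n = sym (trans ([a+m]!≡a!*rising 0 n) (*-identityˡ _))

rising[1,n]≡[1+n]! : ∀ n → rising 1 n ≡ suc n !
rising[1,n]≡[1+n]! n = sym (trans ([a+m]!≡a!*rising 1 n) (*-identityˡ _))

rising-snoc : ∀ a m → rising a (suc m) ≡ rising a m * (a + suc m)
rising-snoc a m = begin
  rising a (suc m)                 ≡⟨ cong (rising a) (+-comm 1 m) ⟩
  rising a (m + 1)                 ≡⟨ rising-+ a m 1 ⟩
  rising a m * (suc (a + m) * 1)   ≡⟨ cong (rising a m *_) (trans (*-identityʳ _) (sym (+-suc a m))) ⟩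
  rising a m * (a + suc m)         ∎
  where open ≡-Reasoning

rising-last : ∀ a m → suc (a + m) ∣ rising a (suc m)
rising-last a m = subst₂ _∣_ (+-suc a m) (sym (rising-snoc a m)) (n∣m*n (rising a m))

data Ascending : ℕ → List ℕ → ℕ → Set where
  done : ∀ {a b} → a ≤ b → Ascending a [] b
  step : ∀ {a x xs b} → a < x → Ascending x xs b → Ascending a (x ∷ xs) b

ascending-≤ : ∀ {a xs b} → Ascending a xs b → a ≤ b
ascending-≤ (done a≤b)   = a≤b
ascending-≤ (step a<x asc) = ≤-trans (<⇒≤ a<x) (ascending-≤ asc)

product-∣-rising : ∀ {a m b xs} → a + m ≡ b → Ascending a xs b → product xs ∣ rising a m
product-∣-rising _ (done _) = 1∣ _
product-∣-rising {a} {m} {xs = x ∷ xs} a+m≡b (step a<x asc)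
  with g , refl ← m≤n⇒∃[o]m+o≡n a<x
     | m′ , x+m′≡b ← m≤n⇒∃[o]m+o≡n (ascending-≤ asc)
  = subst (λ l → x * product xs ∣ rising a l) g+1+m′≡m
      (subst (x * product xs ∣_) (sym (rising-+ a (suc g) m′))
        (*-pres-∣ (rising-last a g)
          (subst (λ y → product xs ∣ rising y m′) (sym (+-suc a g)) (product-∣-rising x+m′≡b asc))))
  where
  g+1+m′≡m : suc g + m′ ≡ m
  g+1+m′≡m = +-cancelˡ-≡ a _ _ (begin
    a + suc (g + m′)  ≡⟨ +-suc a (g + m′) ⟩
    suc (a + (g + m′)) ≡⟨ cong suc (+-assoc a g m′) ⟨
    suc a + g + m′    ≡⟨ x+m′≡b ⟩
    _                 ≡⟨ a+m≡b ⟨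
    a + m             ∎)
    where open ≡-Reasoning

-- The summands of H

term-≡ : ∀ e .{{_ : NonZero e}} {n k r m} X → r + m ≡ n → e * k ≡ m →
         X * (k ! * e ^ k) ≡ rising r m → term e n k ≡ X
term-≡ e {k = k} {r} X refl refl X*D≡rising = trans (/-congˡ {o = D} n!≡X*D) (m*n/n≡m X D)
  where
  open ≡-Reasoning
  D = (r + e * k ∸ e * k) ! * k ! * e ^ k
  instance
    _ = m*n≢0 ((r + e * k ∸ e * k) ! * k !) (e ^ k)
          {{m*n≢0 _ _ {{(r + e * k ∸ e * k) !≢0}} {{k !≢0}}}} {{m^n≢0 e k}}
  n!≡X*D : (r + e * k) ! ≡ X * D
  n!≡X*D = begin
    (r + e * k) !                       ≡⟨ [a+m]!≡a!*rising r (e * k) ⟩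
    r ! * rising r (e * k)              ≡⟨ cong (r ! *_) X*D≡rising ⟨
    r ! * (X * (k ! * e ^ k))           ≡⟨ x∙yz≈y∙xz (r !) X _ ⟩
    X * (r ! * (k ! * e ^ k))           ≡⟨ cong (X *_) (*-assoc (r !) (k !) (e ^ k)) ⟨
    X * (r ! * k ! * e ^ k)             ≡⟨ cong (λ l → X * (l ! * k ! * e ^ k)) (m+n∸n≡m r (e * k)) ⟨
    X * ((r + e * k ∸ e * k) ! * k ! * e ^ k) ∎

term[e,n,0]≡1 : ∀ e .{{_ : NonZero e}} n → term e n 0 ≡ 1
term[e,n,0]≡1 e n = term-≡ e 1 (+-identityʳ n) (*-zeroʳ e) refl

term₁-≡ : ∀ e .{{_ : NonZero e}} {n r} X → X * e ≡ rising r e → r + e ≡ n → term e n 1 ≡ X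
term₁-≡ e X X*e≡rising r+e≡n = term-≡ e X r+e≡n (*-identityʳ e)
  (trans (cong (X *_) (trans (*-identityˡ (e * 1)) (*-identityʳ e))) X*e≡rising)

e*term₁≡rising : ∀ e .{{_ : NonZero e}} {n r xs} q → Ascending r xs n → r + e ≡ n →
                 product xs ≡ q * e → e * term e n 1 ≡ rising r e
e*term₁≡rising e q block r+e≡n xs≡q*e with product-∣-rising r+e≡n block
... | divides q′ rising≡q′*xs =
  trans (cong (e *_) (term₁-≡ e (q′ * q) (sym rising≡q′*q*e) r+e≡n))
        (trans (*-comm e (q′ * q)) (sym rising≡q′*q*e))
  where
  rising≡q′*q*e = trans rising≡q′*xs (trans (cong (q′ *_) xs≡q*e) (sym (*-assoc q′ q e)))

term-divisible : ∀ e .{{_ : NonZero e}} {n k r xs} q c → Ascending r xs n → r + e * k ≡ n →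
                 product xs ≡ q * (c * (k ! * e ^ k)) → c ∣ term e n k
term-divisible e {k = k} q c block r+ek≡n xs≡q*c*D with product-∣-rising r+ek≡n block
... | divides q′ rising≡q′*xs = divides (q′ * q) (term-≡ e (q′ * q * c) r+ek≡n refl (sym (begin
  rising _ (e * k)                 ≡⟨ rising≡q′*xs ⟩
  q′ * _                           ≡⟨ cong (q′ *_) xs≡q*c*D ⟩
  q′ * (q * (c * (k ! * e ^ k)))   ≡⟨ *-assoc q′ q _ ⟨
  q′ * q * (c * (k ! * e ^ k))     ≡⟨ *-assoc (q′ * q) c _ ⟨
  q′ * q * c * (k ! * e ^ k)       ∎)))
  where open ≡-Reasoning

H≡sumUpTo : ∀ e .{{_ : NonZero e}} r K {n} → r < e → r + K * e ≡ n → H e n ≡ sumUpTo e n K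
H≡sumUpTo (suc e) r K r<e refl = cong (sumUpTo (suc e) _) (begin
  (r + K * suc e) / suc e           ≡⟨ +-distrib-/-∣ʳ r (n∣m*n K) ⟩
  r / suc e + K * suc e / suc e     ≡⟨ cong₂ _+_ (m<n⇒m/n≡0 r<e) (m*n/n≡m K (suc e)) ⟩
  K                                 ∎)
  where open ≡-Reasoning

-- Congruences modulo p

module Modulo (p : ℕ) where

  infix 4 _≈_
  record _≈_ (x y : ℤ) : Set where
    constructor mk≈
    field p∣x-y : + p ℤ∣.∣ x ℤ.- y

  ≈-refl : Reflexive _≈_
  ≈-refl {x} = mk≈ (ℤ∣.divides 0ℤ (ℤP.+-inverseʳ x))

  ≈-reflexive : ∀ {x y} → x ≡ y → x ≈ y
  ≈-reflexive refl = ≈-refl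

  ≈-sym : Symmetric _≈_
  ≈-sym {x} {y} (mk≈ p∣x-y) = mk≈ (subst (+ p ℤ∣.∣_) (neg-minus x y) (ℤ∣.∣m⇒∣-m p∣x-y))
    where
    neg-minus : ∀ x y → ℤ.- (x ℤ.- y) ≡ y ℤ.- x
    neg-minus = ℤ-Ring.solve-∀

  ≈-trans : Transitive _≈_
  ≈-trans {x} {y} {z} (mk≈ p∣x-y) (mk≈ p∣y-z) =
    mk≈ (subst (+ p ℤ∣.∣_) (ℤP.+-minus-telescope x y z) (ℤ∣.∣m∣n⇒∣m+n p∣x-y p∣y-z))

  ≈-setoid : Setoid 0ℓ 0ℓ
  ≈-setoid = record
    { Carrier       = ℤ
    ; _≈_           = _≈_
    ; isEquivalence = record { refl = ≈-refl ; sym = ≈-sym ; trans = ≈-trans }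
    }

  +-cong : ∀ {x y u v} → x ≈ y → u ≈ v → x ℤ.+ u ≈ y ℤ.+ v
  +-cong {x} {y} {u} {v} (mk≈ p∣x-y) (mk≈ p∣u-v) =
    mk≈ (subst (+ p ℤ∣.∣_) (regroup x y u v) (ℤ∣.∣m∣n⇒∣m+n p∣x-y p∣u-v))
    where
    regroup : ∀ x y u v → (x ℤ.- y) ℤ.+ (u ℤ.- v) ≡ (x ℤ.+ u) ℤ.- (y ℤ.+ v)
    regroup = ℤ-Ring.solve-∀

  *-cong : ∀ {x y u v} → x ≈ y → u ≈ v → x ℤ.* u ≈ y ℤ.* v
  *-cong {x} {y} {u} {v} (mk≈ p∣x-y) (mk≈ p∣u-v) =
    mk≈ (subst (+ p ℤ∣.∣_) (regroup x y u v)
           (ℤ∣.∣m∣n⇒∣m+n (ℤ∣.∣m⇒∣m*n u p∣x-y) (ℤ∣.∣n⇒∣m*n y p∣u-v)))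
    where
    regroup : ∀ x y u v → (x ℤ.- y) ℤ.* u ℤ.+ y ℤ.* (u ℤ.- v) ≡ x ℤ.* u ℤ.- y ℤ.* v
    regroup = ℤ-Ring.solve-∀

  -‿cong : ∀ {x y} → x ≈ y → ℤ.- x ≈ ℤ.- y
  -‿cong {x} {y} (mk≈ p∣x-y) = mk≈ (subst (+ p ℤ∣.∣_) (neg-distrib x y) (ℤ∣.∣m⇒∣-m p∣x-y))
    where
    neg-distrib : ∀ x y → ℤ.- (x ℤ.- y) ≡ ℤ.- x ℤ.- ℤ.- y
    neg-distrib = ℤ-Ring.solve-∀

  ∣⇒≈0 : ∀ {n} → p ∣ n → + n ≈ 0ℤ
  ∣⇒≈0 {n} p∣n = mk≈ (subst (+ p ℤ∣.∣_) (sym (ℤP.+-identityʳ (+ n))) (ℤ∣.∣ᵤ⇒∣ p∣n))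

  ≈0⇒∣ : ∀ {n} → + n ≈ 0ℤ → p ∣ n
  ≈0⇒∣ {n} (mk≈ p∣n-0) = ℤ∣.∣⇒∣ᵤ (subst (+ p ℤ∣.∣_) (ℤP.+-identityʳ (+ n)) p∣n-0)

  ∣a+b⇒a≈-b : ∀ {a b} → p ∣ a + b → + a ≈ ℤ.- + b
  ∣a+b⇒a≈-b {a} {b} p∣a+b = mk≈ (subst (+ p ℤ∣.∣_) (begin
    + (a + b)            ≡⟨ ℤP.pos-+ a b ⟩
    + a ℤ.+ + b          ≡⟨ cong (ℤ._+_ (+ a)) (ℤP.neg-involutive (+ b)) ⟨
    + a ℤ.- ℤ.- + b      ∎) (ℤ∣.∣ᵤ⇒∣ p∣a+b))
    where open ≡-Reasoning

  *-cancelˡ-≈ : ∀ {a x y} → Coprime p a → + a ℤ.* x ≈ + a ℤ.* y → x ≈ y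
  *-cancelˡ-≈ {a} {x} {y} p⊥a (mk≈ p∣ax-ay) = mk≈ (ℤ∣.∣ᵤ⇒∣ (coprime-divisor p⊥a p∣a*∣x-y∣))
    where
    factor : ∀ a x y → a ℤ.* x ℤ.- a ℤ.* y ≡ a ℤ.* (x ℤ.- y)
    factor = ℤ-Ring.solve-∀
    p∣a*∣x-y∣ : p ∣ a * ℤ.∣ x ℤ.- y ∣
    p∣a*∣x-y∣ = subst (p ∣_) (ℤP.abs-* (+ a) (x ℤ.- y))
                  (ℤ∣.∣⇒∣ᵤ (subst (+ p ℤ∣.∣_) (factor (+ a) x y) p∣ax-ay))

  ∣⇔∣ : ∀ {a b} → + a ≈ + b → p ∣ a ⇔ p ∣ b
  ∣⇔∣ a≈b = mk⇔ (λ p∣a → ≈0⇒∣ (≈-trans (≈-sym a≈b) (∣⇒≈0 p∣a)))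
                (λ p∣b → ≈0⇒∣ (≈-trans a≈b (∣⇒≈0 p∣b)))

  ∣⇔∣-neg : ∀ {a b} → + a ≈ ℤ.- + b → p ∣ a ⇔ p ∣ b
  ∣⇔∣-neg {a} {b} a≈-b = mk⇔
    (λ p∣a → ≈0⇒∣ (≈-trans (≈-reflexive (sym (ℤP.neg-involutive (+ b))))
                           (-‿cong (≈-trans (≈-sym a≈-b) (∣⇒≈0 p∣a)))))
    (λ p∣b → ≈0⇒∣ (≈-trans a≈-b (-‿cong (∣⇒≈0 p∣b))))

  module ≈-Reasoning = Relation.Binary.Reasoning.Setoid ≈-setoid

  rising-periodic : ∀ {b} a m → b ≡ p + a → + rising b m ≈ + rising a m
  rising-periodic a zero    _    = ≈-refl
  rising-periodic a (suc m) refl = begin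
    + rising (p + a) (suc m)                    ≡⟨ ℤP.pos-* (suc (p + a)) _ ⟩
    + suc (p + a) ℤ.* + rising (suc (p + a)) m  ≈⟨ *-cong p+a+1≈a+1 (rising-periodic (suc a) m (sym (+-suc p a))) ⟩
    + suc a ℤ.* + rising (suc a) m              ≡⟨ ℤP.pos-* (suc a) _ ⟨
    + rising a (suc m)                          ∎
    where
    open ≈-Reasoning
    p+a+1≈a+1 : + suc (p + a) ≈ + suc a
    p+a+1≈a+1 = begin
      + suc (p + a)        ≡⟨ cong +_ (+-suc p a) ⟨
      + (p + suc a)        ≡⟨ ℤP.pos-+ p (suc a) ⟩
      + p ℤ.+ + suc a      ≈⟨ +-cong (∣⇒≈0 ∣-refl) (≈-refl {+ suc a}) ⟩
      + suc a              ∎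

  rising-reflect : ∀ a b m → p ∣ a + b + suc m → + rising a m ≈ -1ℤ ℤ.^ m ℤ.* + rising b m
  rising-reflect a b zero    _ = ≈-refl
  rising-reflect a b (suc m) p∣a+b+m+2 = begin
    + rising a (suc m)                                     ≡⟨ ℤP.pos-* (suc a) _ ⟩
    + suc a ℤ.* + rising (suc a) m                         ≈⟨ *-cong (∣a+b⇒a≈-b {suc a} {b + suc m} p∣a+1+[b+m+1])
                                                                     (rising-reflect (suc a) b m p∣a+1+b+m+1) ⟩
    ℤ.- + (b + suc m) ℤ.* (-1ℤ ℤ.^ m ℤ.* + rising b m)     ≡⟨ regroup (+ (b + suc m)) (-1ℤ ℤ.^ m) (+ rising b m) ⟩
    -1ℤ ℤ.^ suc m ℤ.* (+ rising b m ℤ.* + (b + suc m))     ≡⟨ cong (ℤ._*_ (-1ℤ ℤ.^ suc m)) (ℤP.pos-* (rising b m) (b + suc m)) ⟨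
    -1ℤ ℤ.^ suc m ℤ.* + (rising b m * (b + suc m))         ≡⟨ cong (λ r → -1ℤ ℤ.^ suc m ℤ.* + r) (rising-snoc b m) ⟨
    -1ℤ ℤ.^ suc m ℤ.* + rising b (suc m)                   ∎
    where
    open ≈-Reasoning
    p∣a+1+b+m+1 : p ∣ suc a + b + suc m
    p∣a+1+b+m+1 = subst (p ∣_) (+-suc (a + b) (suc m)) p∣a+b+m+2
    p∣a+1+[b+m+1] : p ∣ suc a + (b + suc m)
    p∣a+1+[b+m+1] = subst (p ∣_) (cong suc (+-assoc a b (suc m))) p∣a+1+b+m+1
    regroup : ∀ x s f → ℤ.- x ℤ.* (s ℤ.* f) ≡ -1ℤ ℤ.* s ℤ.* (f ℤ.* x)
    regroup = ℤ-Ring.solve-∀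

  sumUpTo≈1+term₁ : ∀ e .{{_ : NonZero e}} n K → (∀ {k} → k < K → p ∣ term e n (2 + k)) →
                    + sumUpTo e n (suc K) ≈ 1ℤ ℤ.+ + term e n 1
  sumUpTo≈1+term₁ e n zero    _         =
    ≈-reflexive (trans (cong (λ t₀ → + (t₀ + term e n 1)) (term[e,n,0]≡1 e n)) (ℤP.pos-+ 1 _))
  sumUpTo≈1+term₁ e n (suc K) vanishing = begin
    + (sumUpTo e n (suc K) + term e n (2 + K))      ≡⟨ ℤP.pos-+ (sumUpTo e n (suc K)) _ ⟩
    + sumUpTo e n (suc K) ℤ.+ + term e n (2 + K)    ≈⟨ +-cong (sumUpTo≈1+term₁ e n K (vanishing ∘ m<n⇒m<1+n))
                                                                (∣⇒≈0 (vanishing (n<1+n K))) ⟩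
    (1ℤ ℤ.+ + term e n 1) ℤ.+ 0ℤ                    ≡⟨ ℤP.+-identityʳ _ ⟩
    1ℤ ℤ.+ + term e n 1                             ∎
    where open ≈-Reasoning

1-n≡-[n∸1] : ∀ n .{{_ : NonZero n}} → 1ℤ ℤ.- + n ≡ ℤ.- + (n ∸ 1)
1-n≡-[n∸1] n = trans (ℤP.m-n≡m⊖n 1 n) (ℤP.⊖-≤ (>-nonZero⁻¹ n))

-1^[2m+1]≡-1 : ∀ m → -1ℤ ℤ.^ (2 * m + 1) ≡ -1ℤ
-1^[2m+1]≡-1 m = begin
  -1ℤ ℤ.^ (2 * m + 1)              ≡⟨ ℤP.^-distribˡ-+-* -1ℤ (2 * m) 1 ⟩
  -1ℤ ℤ.^ (2 * m) ℤ.* -1ℤ ℤ.^ 1    ≡⟨ cong (ℤ._* -1ℤ ℤ.^ 1) (ℤP.^-*-assoc -1ℤ 2 m) ⟨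
  1ℤ ℤ.^ m ℤ.* -1ℤ ℤ.^ 1           ≡⟨ cong (ℤ._* -1ℤ ℤ.^ 1) (ℤP.^-zeroˡ m) ⟩
  -1ℤ                              ∎
  where open ≡-Reasoning

2n+1⊥n : ∀ n → Coprime (2 * n + 1) n
2n+1⊥n n (i∣2n+1 , i∣n) = ∣1⇒≡1 (∣m+n∣m⇒∣n i∣2n+1 (∣n⇒∣m*n 2 i∣n))

≤-witness : ∀ {m n} o → m + o ≡ n → m ≤ n
≤-witness o refl = m≤m+n _ o

-- The case p = 2d + 1

module Congruences (d : ℕ) (3≤d : 3 ≤ d) where

  private instance
    d≢0 : NonZero d
    d≢0 = >-nonZero (≤-trans (s≤s z≤n) 3≤d)
    2d+1≢0 : NonZero (2 * d + 1)
    2d+1≢0 = >-nonZero (m≤n+m 1 (2 * d))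

  open Modulo (2 * d + 1)

  d+2<2d : d + 2 < 2 * d
  d+2<2d with t , refl ← m≤n⇒∃[o]m+o≡n 3≤d = ≤-witness t (solve (t ∷ []))

  2d<2d+1 : 2 * d < 2 * d + 1
  2d<2d+1 = m<m+n (2 * d) z<s

  2d+1<3d : 2 * d + 1 < 3 * d
  2d+1<3d with t , refl ← m≤n⇒∃[o]m+o≡n 3≤d = ≤-witness (1 + t) (solve (t ∷ []))

  2d+2<3d : 2 * d + 2 < 3 * d
  2d+2<3d with t , refl ← m≤n⇒∃[o]m+o≡n 3≤d = ≤-witness t (solve (t ∷ []))

  d<2d : d < 2 * d
  d<2d with t , refl ← m≤n⇒∃[o]m+o≡n 3≤d = ≤-witness (2 + t) (solve (t ∷ []))

  3d<4d : 3 * d < 4 * d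
  3d<4d with t , refl ← m≤n⇒∃[o]m+o≡n 3≤d = ≤-witness (2 + t) (solve (t ∷ []))

  0<d : 0 < d
  0<d = ≤-trans (s≤s z≤n) 3≤d

  d+1≈-d : + suc d ≈ ℤ.- + d
  d+1≈-d = ∣a+b⇒a≈-b (∣-reflexive (solve (d ∷ [])))

  p∣term[d,3d+2,2] : 2 * d + 1 ∣ term d (3 * d + 2) 2
  p∣term[d,3d+2,2] = term-divisible d 3 (2 * d + 1)
    (step d+2<2d (step 2d<2d+1 (step 2d+1<3d (done (m≤m+n (3 * d) 2)))))
    (solve (d ∷ []))
    (2 * d * ((2 * d + 1) * (3 * d * 1))
       ≡ 3 * ((2 * d + 1) * (2 ! * (d * (d * 1))))             ∋ solve (d ∷ []))

  p∣term[d,3d+2,3] : 2 * d + 1 ∣ term d (3 * d + 2) 3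
  p∣term[d,3d+2,3] = term-divisible d 1 (2 * d + 1)
    (step 3≤d (step d<2d (step 2d<2d+1 (step 2d+1<3d (done (m≤m+n (3 * d) 2))))))
    (solve (d ∷ []))
    (d * (2 * d * ((2 * d + 1) * (3 * d * 1)))
       ≡ 1 * ((2 * d + 1) * (3 ! * (d * (d * (d * 1)))))       ∋ solve (d ∷ []))

  term[d,3d+2,1]≈-d! : + term d (3 * d + 2) 1 ≈ ℤ.- + (d !)
  term[d,3d+2,1]≈-d! = *-cancelˡ-≈ (2n+1⊥n d) (begin
    + d ℤ.* + term d (3 * d + 2) 1   ≡⟨ ℤP.pos-* d _ ⟨
    + (d * term d (3 * d + 2) 1)     ≡⟨ cong +_ d*term≡rising ⟩
    + rising (2 * d + 2) d           ≈⟨ rising-periodic 1 d (solve (d ∷ [])) ⟩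
    + rising 1 d                     ≡⟨ cong +_ (rising[1,n]≡[1+n]! d) ⟩
    + (suc d * d !)                  ≡⟨ ℤP.pos-* (suc d) (d !) ⟩
    + suc d ℤ.* + (d !)              ≈⟨ *-cong d+1≈-d ≈-refl ⟩
    ℤ.- + d ℤ.* + (d !)              ≡⟨ ℤP.neg-distribˡ-* (+ d) (+ (d !)) ⟨
    ℤ.- (+ d ℤ.* + (d !))            ≡⟨ ℤP.neg-distribʳ-* (+ d) (+ (d !)) ⟩
    + d ℤ.* ℤ.- + (d !)              ∎)
    where
    open ≈-Reasoning
    d*term≡rising : d * term d (3 * d + 2) 1 ≡ rising (2 * d + 2) d
    d*term≡rising = e*term₁≡rising d 3 (step 2d+2<3d (done (m≤m+n (3 * d) 2))) (solve (d ∷ []))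
                      (3 * d * 1 ≡ 3 * d ∋ solve (d ∷ []))

  H[d,3d+2]≈1-d! : + H d (3 * d + 2) ≈ ℤ.- + (d ! ∸ 1)
  H[d,3d+2]≈1-d! = begin
    + H d (3 * d + 2)                ≡⟨ cong +_ (H≡sumUpTo d 2 3 3≤d (+-comm 2 (3 * d))) ⟩
    + sumUpTo d (3 * d + 2) 3        ≈⟨ sumUpTo≈1+term₁ d (3 * d + 2) 2 (λ { z<s → p∣term[d,3d+2,2]
                                                                            ; (s<s z<s) → p∣term[d,3d+2,3] }) ⟩
    1ℤ ℤ.+ + term d (3 * d + 2) 1    ≈⟨ +-cong (≈-refl {1ℤ}) term[d,3d+2,1]≈-d! ⟩
    1ℤ ℤ.- + (d !)                   ≡⟨ 1-n≡-[n∸1] (d !) {{d !≢0}} ⟩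
    ℤ.- + (d ! ∸ 1)                  ∎
    where open ≈-Reasoning

  p∣term[d,4d,2] : 2 * d + 1 ∣ term d (4 * d) 2
  p∣term[d,4d,2] = term-divisible d 6 (2 * d + 1)
    (step 2d<2d+1 (step 2d+1<3d (step 3d<4d (done ≤-refl))))
    (solve (d ∷ []))
    ((2 * d + 1) * (3 * d * (4 * d * 1))
       ≡ 6 * ((2 * d + 1) * (2 ! * (d * (d * 1))))             ∋ solve (d ∷ []))

  p∣term[d,4d,3] : 2 * d + 1 ∣ term d (4 * d) 3
  p∣term[d,4d,3] = term-divisible d 4 (2 * d + 1)
    (step d<2d (step 2d<2d+1 (step 2d+1<3d (step 3d<4d (done ≤-refl)))))
    (solve (d ∷ []))
    (2 * d * ((2 * d + 1) * (3 * d * (4 * d * 1)))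
       ≡ 4 * ((2 * d + 1) * (3 ! * (d * (d * (d * 1)))))       ∋ solve (d ∷ []))

  p∣term[d,4d,4] : 2 * d + 1 ∣ term d (4 * d) 4
  p∣term[d,4d,4] = term-divisible d 1 (2 * d + 1)
    (step 0<d (step d<2d (step 2d<2d+1 (step 2d+1<3d (step 3d<4d (done ≤-refl))))))
    (solve (d ∷ []))
    (d * (2 * d * ((2 * d + 1) * (3 * d * (4 * d * 1))))
       ≡ 1 * ((2 * d + 1) * (4 ! * (d * (d * (d * (d * 1)))))) ∋ solve (d ∷ []))

  module Odd (d-odd : -1ℤ ℤ.^ d ≡ -1ℤ) where

    rising[d,d]≈-d! : + rising d d ≈ ℤ.- + (d !)
    rising[d,d]≈-d! = begin
      + rising d d                 ≈⟨ rising-reflect d 0 d (∣-reflexive (solve (d ∷ []))) ⟩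
      -1ℤ ℤ.^ d ℤ.* + rising 0 d   ≡⟨ cong₂ ℤ._*_ d-odd (cong +_ (rising[0,n]≡n! d)) ⟩
      -1ℤ ℤ.* + (d !)              ≡⟨ ℤP.-1*i≡-i (+ (d !)) ⟩
      ℤ.- + (d !)                  ∎
      where open ≈-Reasoning

    term[d,4d,1]≈d! : + term d (4 * d) 1 ≈ + (d !)
    term[d,4d,1]≈d! = *-cancelˡ-≈ (2n+1⊥n d) (begin
      + d ℤ.* + term d (4 * d) 1      ≡⟨ ℤP.pos-* d _ ⟨
      + (d * term d (4 * d) 1)        ≡⟨ cong +_ d*term≡rising ⟩
      + rising (3 * d) d              ≈⟨ rising-reflect (3 * d) 1 d (divides 2 (solve (d ∷ []))) ⟩
      -1ℤ ℤ.^ d ℤ.* + rising 1 d      ≡⟨ cong₂ ℤ._*_ d-odd (cong +_ (rising[1,n]≡[1+n]! d)) ⟩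
      -1ℤ ℤ.* + (suc d * d !)         ≡⟨ cong (ℤ._*_ -1ℤ) (ℤP.pos-* (suc d) (d !)) ⟩
      -1ℤ ℤ.* (+ suc d ℤ.* + (d !))   ≈⟨ *-cong (≈-refl { -1ℤ}) (*-cong d+1≈-d ≈-refl) ⟩
      -1ℤ ℤ.* (ℤ.- + d ℤ.* + (d !))   ≡⟨ sign-cancel (+ d) (+ (d !)) ⟩
      + d ℤ.* + (d !)                 ∎)
      where
      open ≈-Reasoning
      d*term≡rising : d * term d (4 * d) 1 ≡ rising (3 * d) d
      d*term≡rising = e*term₁≡rising d 4 (step 3d<4d (done ≤-refl)) (solve (d ∷ []))
                        (4 * d * 1 ≡ 4 * d ∋ solve (d ∷ []))
      sign-cancel : ∀ x y → -1ℤ ℤ.* (ℤ.- x ℤ.* y) ≡ x ℤ.* y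
      sign-cancel = ℤ-Ring.solve-∀

    H[d,4d]≈1+d! : + H d (4 * d) ≈ + (d ! + 1)
    H[d,4d]≈1+d! = begin
      + H d (4 * d)                   ≡⟨ cong +_ (H≡sumUpTo d 0 4 0<d refl) ⟩
      + sumUpTo d (4 * d) 4           ≈⟨ sumUpTo≈1+term₁ d (4 * d) 3 (λ { z<s → p∣term[d,4d,2]
                                                                         ; (s<s z<s) → p∣term[d,4d,3]
                                                                         ; (s<s (s<s z<s)) → p∣term[d,4d,4] }) ⟩
      1ℤ ℤ.+ + term d (4 * d) 1       ≈⟨ +-cong (≈-refl {1ℤ}) term[d,4d,1]≈d! ⟩
      1ℤ ℤ.+ + (d !)                  ≡⟨ ℤP.+-comm 1ℤ (+ (d !)) ⟩
      + (d !) ℤ.+ 1ℤ                  ≡⟨ ℤP.pos-+ (d !) 1 ⟨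
      + (d ! + 1)                     ∎
      where open ≈-Reasoning

    -- These summands involve d − 1 and 2d − 1, which are not polynomial in d; so write d = 3 + t.
    term[p,3d+2,1]≈-d!² : + term (2 * d + 1) (3 * d + 2) 1 ≈ ℤ.- (+ (d !) ℤ.* + (d !))
    term[p,3d+2,1]≈-d!² with t , refl ← m≤n⇒∃[o]m+o≡n 3≤d = let open ≈-Reasoning in begin
      + term (2 * (3 + t) + 1) (3 * (3 + t) + 2) 1   ≡⟨ cong +_ (term₁-≡ (2 * (3 + t) + 1) {n = 3 * (3 + t) + 2}
                                                          (A * B) A*B*p≡rising (solve (t ∷ []))) ⟩
      + (A * B)                                      ≡⟨ ℤP.pos-* A B ⟩
      + A ℤ.* + B                                    ≈⟨ *-cong (≈-refl {+ A})
                                                          (rising-periodic 0 (4 + t) (sym (+-identityʳ _))) ⟩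
      + A ℤ.* + rising 0 (4 + t)                     ≡⟨ cong (λ x → + A ℤ.* + x) (rising[0,n]≡n! (4 + t)) ⟩
      + A ℤ.* + ((4 + t) * (3 + t) !)                ≡⟨ cong (ℤ._*_ (+ A)) (ℤP.pos-* (4 + t) ((3 + t) !)) ⟩
      + A ℤ.* (+ (4 + t) ℤ.* + ((3 + t) !))          ≡⟨ regroup (+ A) (+ (4 + t)) (+ ((3 + t) !)) ⟩
      + (4 + t) ℤ.* + A ℤ.* + ((3 + t) !)            ≡⟨ cong (ℤ._* + ((3 + t) !)) (ℤP.pos-* (4 + t) A) ⟨
      + rising (3 + t) (3 + t) ℤ.* + ((3 + t) !)     ≈⟨ *-cong rising[d,d]≈-d! (≈-refl {+ ((3 + t) !)}) ⟩
      ℤ.- + ((3 + t) !) ℤ.* + ((3 + t) !)            ≡⟨ ℤP.neg-distribˡ-* (+ ((3 + t) !)) _ ⟨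
      ℤ.- (+ ((3 + t) !) ℤ.* + ((3 + t) !))          ∎
      where
      A = rising (4 + t) (2 + t)
      B = rising (2 * (3 + t) + 1) (4 + t)
      A*B*p≡rising : A * B * (2 * (3 + t) + 1) ≡ rising (4 + t) (2 * (3 + t) + 1)
      A*B*p≡rising = begin
        A * B * (2 * (3 + t) + 1)                    ≡⟨ x∙yz≈xz∙y A (2 * (3 + t) + 1) B ⟨
        A * ((2 * (3 + t) + 1) * B)                  ≡⟨ cong (λ x → A * (x * rising x (4 + t)))
                                                          (2 * (3 + t) + 1 ≡ suc (4 + t + (2 + t)) ∋ solve (t ∷ [])) ⟩
        A * rising (4 + t + (2 + t)) (suc (4 + t))   ≡⟨ rising-+ (4 + t) (2 + t) (suc (4 + t)) ⟨
        rising (4 + t) (2 + t + suc (4 + t))         ≡⟨ cong (rising (4 + t))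
                                                          (2 + t + suc (4 + t) ≡ 2 * (3 + t) + 1 ∋ solve (t ∷ [])) ⟩
        rising (4 + t) (2 * (3 + t) + 1)             ∎
        where open ≡-Reasoning
      regroup : ∀ x y z → x ℤ.* (y ℤ.* z) ≡ y ℤ.* x ℤ.* z
      regroup = ℤ-Ring.solve-∀

    term[p,4d,1]≈-d!² : + term (2 * d + 1) (4 * d) 1 ≈ ℤ.- (+ (d !) ℤ.* + (d !))
    term[p,4d,1]≈-d!² with t , refl ← m≤n⇒∃[o]m+o≡n 3≤d = let open ≈-Reasoning in begin
      + term (2 * (3 + t) + 1) (4 * (3 + t)) 1       ≡⟨ cong +_ (term₁-≡ (2 * (3 + t) + 1) {n = 4 * (3 + t)}
                                                          ((6 + 2 * t) * R) X*p≡rising (solve (t ∷ []))) ⟩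
      + ((6 + 2 * t) * R)                            ≡⟨ ℤP.pos-* (6 + 2 * t) R ⟩
      + (6 + 2 * t) ℤ.* + R                          ≈⟨ *-cong (≈-refl {+ (6 + 2 * t)}) (rising-periodic 0 (5 + 2 * t)
                                                          (7 + 2 * t ≡ 2 * (3 + t) + 1 + 0 ∋ solve (t ∷ []))) ⟩
      + (6 + 2 * t) ℤ.* + rising 0 (5 + 2 * t)       ≡⟨ cong (λ x → + (6 + 2 * t) ℤ.* + x) (rising[0,n]≡n! (5 + 2 * t)) ⟩
      + (6 + 2 * t) ℤ.* + ((5 + 2 * t) !)            ≡⟨ ℤP.pos-* (6 + 2 * t) ((5 + 2 * t) !) ⟨
      + ((6 + 2 * t) !)                              ≡⟨ cong (λ m → + (m !)) (6 + 2 * t ≡ 3 + t + (3 + t) ∋ solve (t ∷ [])) ⟩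
      + ((3 + t + (3 + t)) !)                        ≡⟨ cong +_ ([a+m]!≡a!*rising (3 + t) (3 + t)) ⟩
      + ((3 + t) ! * rising (3 + t) (3 + t))         ≡⟨ ℤP.pos-* ((3 + t) !) (rising (3 + t) (3 + t)) ⟩
      + ((3 + t) !) ℤ.* + rising (3 + t) (3 + t)     ≈⟨ *-cong (≈-refl {+ ((3 + t) !)}) rising[d,d]≈-d! ⟩
      + ((3 + t) !) ℤ.* ℤ.- + ((3 + t) !)            ≡⟨ ℤP.neg-distribʳ-* (+ ((3 + t) !)) _ ⟨
      ℤ.- (+ ((3 + t) !) ℤ.* + ((3 + t) !))          ∎
      where
      R = rising (7 + 2 * t) (5 + 2 * t)
      X*p≡rising : (6 + 2 * t) * R * (2 * (3 + t) + 1) ≡ rising (5 + 2 * t) (2 * (3 + t) + 1)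
      X*p≡rising = begin
        (6 + 2 * t) * R * (2 * (3 + t) + 1)          ≡⟨ x∙yz≈xz∙y (6 + 2 * t) (2 * (3 + t) + 1) R ⟨
        (6 + 2 * t) * ((2 * (3 + t) + 1) * R)        ≡⟨ cong (λ x → (6 + 2 * t) * (x * R))
                                                          (2 * (3 + t) + 1 ≡ 7 + 2 * t ∋ solve (t ∷ [])) ⟩
        rising (5 + 2 * t) (2 + (5 + 2 * t))         ≡⟨ cong (rising (5 + 2 * t))
                                                          (2 + (5 + 2 * t) ≡ 2 * (3 + t) + 1 ∋ solve (t ∷ [])) ⟩
        rising (5 + 2 * t) (2 * (3 + t) + 1)         ∎
        where open ≡-Reasoning

    1-d!²≡-[d!²∸1] : 1ℤ ℤ.- (+ (d !) ℤ.* + (d !)) ≡ ℤ.- + ((d !) ^ 2 ∸ 1)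
    1-d!²≡-[d!²∸1] = begin
      1ℤ ℤ.- (+ (d !) ℤ.* + (d !))    ≡⟨ cong (λ x → 1ℤ ℤ.- x) (ℤP.pos-* (d !) (d !)) ⟨
      1ℤ ℤ.- + (d ! * d !)             ≡⟨ cong (λ x → 1ℤ ℤ.- + (d ! * x)) (*-identityʳ (d !)) ⟨
      1ℤ ℤ.- + ((d !) ^ 2)             ≡⟨ 1-n≡-[n∸1] ((d !) ^ 2) {{m^n≢0 (d !) 2 {{d !≢0}}}} ⟩
      ℤ.- + ((d !) ^ 2 ∸ 1)            ∎
      where open ≡-Reasoning

    H[p,3d+2]≈1-d!² : + H (2 * d + 1) (3 * d + 2) ≈ ℤ.- + ((d !) ^ 2 ∸ 1)
    H[p,3d+2]≈1-d!² = begin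
      + H (2 * d + 1) (3 * d + 2)               ≡⟨ cong +_ (H≡sumUpTo (2 * d + 1) (d + 1) 1 (+-monoˡ-< 1 d<2d)
                                                     (solve (d ∷ []))) ⟩
      + sumUpTo (2 * d + 1) (3 * d + 2) 1       ≈⟨ sumUpTo≈1+term₁ (2 * d + 1) (3 * d + 2) 0 (λ ()) ⟩
      1ℤ ℤ.+ + term (2 * d + 1) (3 * d + 2) 1   ≈⟨ +-cong (≈-refl {1ℤ}) term[p,3d+2,1]≈-d!² ⟩
      1ℤ ℤ.- (+ (d !) ℤ.* + (d !))              ≡⟨ 1-d!²≡-[d!²∸1] ⟩
      ℤ.- + ((d !) ^ 2 ∸ 1)                     ∎
      where open ≈-Reasoning

    H[p,4d]≈1-d!² : + H (2 * d + 1) (4 * d) ≈ ℤ.- + ((d !) ^ 2 ∸ 1)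
    H[p,4d]≈1-d!² = begin
      + H (2 * d + 1) (4 * d)                   ≡⟨ cong +_ H[p,4d]≡sumUpTo ⟩
      + sumUpTo (2 * d + 1) (4 * d) 1           ≈⟨ sumUpTo≈1+term₁ (2 * d + 1) (4 * d) 0 (λ ()) ⟩
      1ℤ ℤ.+ + term (2 * d + 1) (4 * d) 1       ≈⟨ +-cong (≈-refl {1ℤ}) term[p,4d,1]≈-d!² ⟩
      1ℤ ℤ.- (+ (d !) ℤ.* + (d !))              ≡⟨ 1-d!²≡-[d!²∸1] ⟩
      ℤ.- + ((d !) ^ 2 ∸ 1)                     ∎
      where
      open ≈-Reasoning
      H[p,4d]≡sumUpTo : H (2 * d + 1) (4 * d) ≡ sumUpTo (2 * d + 1) (4 * d) 1
      H[p,4d]≡sumUpTo with t , refl ← m≤n⇒∃[o]m+o≡n 3≤d =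
        H≡sumUpTo (2 * (3 + t) + 1) (5 + 2 * t) 1 (≤-witness 1 (solve (t ∷ []))) (solve (t ∷ []))

mainTheorem12 : (d : ℕ) → 3 ≤ d →
    ((2 * d + 1 ∣ H d (3 * d + 2)) ⇔ (2 * d + 1 ∣ d ! ∸ 1))
    × ((∃[ m ] d ≡ 2 * m + 1) →
        ((2 * d + 1 ∣ H (2 * d + 1) (3 * d + 2)) ⇔ (2 * d + 1 ∣ (d !) ^ 2 ∸ 1))
        × ((2 * d + 1 ∣ H d (4 * d)) ⇔ (2 * d + 1 ∣ d ! + 1))
        × ((2 * d + 1 ∣ H (2 * d + 1) (4 * d)) ⇔ (2 * d + 1 ∣ (d !) ^ 2 ∸ 1)))
mainTheorem12 d 3≤d =
  ∣⇔∣-neg H[d,3d+2]≈1-d! ,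
  λ { (m , d≡2m+1) →
        let open Odd (trans (cong (-1ℤ ℤ.^_) d≡2m+1) (-1^[2m+1]≡-1 m))
        in ∣⇔∣-neg H[p,3d+2]≈1-d!² , ∣⇔∣ H[d,4d]≈1+d! , ∣⇔∣-neg H[p,4d]≈1-d!² }
  where
  open Congruences d 3≤d
  open Modulo (2 * d + 1) using (∣⇔∣; ∣⇔∣-neg)
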